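{- Let $G$ be drawn from the graph model and let $G_{\mathrm{pre}}$ be any graph that yields $G$ with nonzero probability under the adversary. Then every good node has degree at least $3$ in $G$.
   Context: Graph model with constants $a>b>0$, $\varepsilon=\frac{b}{a+b}$, $\delta=1$ if $\varepsilon\le\frac13$ and $\delta=(1-2\varepsilon)^2/\varepsilon^2$ otherwise: spins $\sigma_v\in\{\pm1\}$ i.i.d.\ uniform on $n$ vertices; precursor $G_{\mathrm{pre}}$ has each pair as an edge independently with probability $a/n$ (equal spins) or $b/n$ (opposite spins). The adversary, acting on $G_{\mathrm{pre}}$: mark $v$ "good" if at least 3 neighbours of $v$ in $G_{\mathrm{pre}}$ have degree $\ne2$; mark a degree-2 vertex "marked" if both neighbours are good; for each marked $v$ whose two neighbours both have spin opposite to $v$, independently with probability $\delta$ delete both edges incident to $v$. The result is $G$; markings refer to $G_{\mathrm{pre}}$.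
   Formalization: The constants $a$ and $b$ of the graph model are taken to be rational numbers. -}

module Defs where

open import Data.Nat using (ℕ; _≤_)
open import Data.Bool using (Bool; true; false; _∧_; not; if_then_else_)
open import Data.Fin using (Fin)
open import Data.List using (List; map)
open import Data.Nat.ListAction using (sum)
open import Data.List using () renaming (allFin to allFinL)
open import Data.Nat using (_≟_)
open import Relation.Nullary using (¬_; does)
open import Data.Product using (_×_)
open import Relation.Binary.PropositionalEquality using (_≡_; _≢_)

record SimpleGraph (n : ℕ) : Set where
  field
    adj    : Fin n → Fin n → Bool
    sym    : ∀ u v → adj u v ≡ adj v u
    irrefl : ∀ v → adj v v ≡ false
open SimpleGraph public

countV : {n : ℕ} → (Fin n → Bool) → ℕ
countV {n} p = sum (map (λ u → if p u then 1 else 0) (allFinL n))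

degree : {n : ℕ} → (Fin n → Fin n → Bool) → Fin n → ℕ
degree E v = countV (λ u → E v u)

Good : {n : ℕ} → (Fin n → Fin n → Bool) → Fin n → Set
Good E v = 3 ≤ countV (λ u → E v u ∧ not (does (degree E u ≟ 2)))

Marked : {n : ℕ} → (Fin n → Fin n → Bool) → Fin n → Set
Marked E v = (degree E v ≡ 2) × (∀ u → E v u ≡ true → Good E u)

-- Spins are Booleans (true = +1, false = -1).
-- v is eligible for deletion: marked, and both neighbours have spin opposite to v.
Eligible : {n : ℕ} → (Fin n → Bool) → (Fin n → Fin n → Bool) → Fin n → Set
Eligible σ E v = Marked E v × (∀ u → E v u ≡ true → σ u ≢ σ v)

deleteAt : {n : ℕ} → (Fin n → Fin n → Bool) → (Fin n → Bool) → Fin n → Fin n → Bool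
deleteAt E D u v = E u v ∧ not (D u) ∧ not (D v)

-- A good vertex has at least three neighbours of degree ≠ 2, so it has degree ≥ 3
-- itself.  The adversary only deletes vertices of degree 2, hence neither the good
-- vertex nor any of those neighbours is deleted, and all these edges survive in G.
module Submission where

open import Defs
open import Data.Nat using (ℕ)
open import Data.Bool using (Bool; true)
open import Data.Fin using (Fin)
open import Data.Rational using (ℚ; 0ℚ; _<_; _+_)
open import Relation.Binary.PropositionalEquality using (_≡_)

open import Data.Bool using (false; _∧_; not; if_then_else_)
open import Data.Bool.Properties using (∧-conicalˡ; ∧-conicalʳ)
open import Data.List using (List; []; _∷_; map)
open import Data.List using () renaming (allFin to allFinL)
open import Data.Nat using (_≤_; _≟_; s≤s)
open import Data.Nat.ListAction using (sum)
open import Data.Nat.Properties using (≤-trans; ≤-reflexive; m≤n⇒m≤1+n)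
open import Data.Product using (proj₁)
open import Relation.Binary.PropositionalEquality as ≡ using (_≢_; refl; trans)
open import Relation.Nullary using (Dec; yes; no; does; ¬_)

count-mono : {A : Set} (p q : A → Bool) → (∀ x → p x ≡ true → q x ≡ true) →
  (xs : List A) →
  sum (map (λ x → if p x then 1 else 0) xs) ≤ sum (map (λ x → if q x then 1 else 0) xs)
count-mono p q p⇒q [] = ≤-reflexive refl
count-mono p q p⇒q (x ∷ xs) with p x in px | q x in qx
... | true  | true  = s≤s (count-mono p q p⇒q xs)
... | true  | false with () ← trans (≡.sym (p⇒q x px)) qx
... | false | true  = m≤n⇒m≤1+n (count-mono p q p⇒q xs)
... | false | false = count-mono p q p⇒q xs

countV-mono : {n : ℕ} (p q : Fin n → Bool) → (∀ u → p u ≡ true → q u ≡ true) →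
  countV p ≤ countV q
countV-mono {n} p q p⇒q = count-mono p q p⇒q (allFinL n)

not-does⇒¬ : {A : Set} (a? : Dec A) → not (does a?) ≡ true → ¬ A
not-does⇒¬ (yes _) ()
not-does⇒¬ (no ¬a) _ = ¬a

module _ {n : ℕ} (E : Fin n → Fin n → Bool) where

  good⇒3≤degree : ∀ {v} → Good E v → 3 ≤ degree E v
  good⇒3≤degree {v} good =
    ≤-trans good (countV-mono _ (E v) (λ u → ∧-conicalˡ (E v u) _))

  good⇒degree≢2 : ∀ {v} → Good E v → degree E v ≢ 2
  good⇒degree≢2 good deg≡2 with ≤-trans (good⇒3≤degree good) (≤-reflexive deg≡2)
  ... | s≤s (s≤s ())

  deleteAt-preserves-good : (D : Fin n → Bool) →
    (∀ u → D u ≡ true → degree E u ≡ 2) →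
    ∀ {v} → Good E v → 3 ≤ degree (deleteAt E D) v
  deleteAt-preserves-good D deleted⇒degree2 {v} good =
    ≤-trans good (countV-mono _ _ survives)
    where
    undeleted : ∀ {u} → degree E u ≢ 2 → D u ≡ false
    undeleted {u} deg≢2 with D u in du
    ... | false = refl
    ... | true  with () ← deg≢2 (deleted⇒degree2 u du)

    survives : ∀ u → (E v u ∧ not (does (degree E u ≟ 2))) ≡ true →
      deleteAt E D v u ≡ true
    survives u counted
      rewrite ∧-conicalˡ (E v u) _ counted
            | undeleted (good⇒degree≢2 good)
            | undeleted (not-does⇒¬ (degree E u ≟ 2) (∧-conicalʳ (E v u) _ counted))
      = refl

-- The spin condition and the deletion probability are irrelevant: it only matters
-- that every deleted vertex is marked, hence of degree 2 in G_pre.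
mainTheorem6 : (a b : ℚ) → 0ℚ < b → b < a →
    (n : ℕ) (Gpre : SimpleGraph n) (σ : Fin n → Bool) (D : Fin n → Bool) →
    (∀ v → D v ≡ true → Eligible σ (adj Gpre) v) →
    ((b + b) Data.Rational.≤ a → ∀ v → Eligible σ (adj Gpre) v → D v ≡ true) →
    ∀ v → Good (adj Gpre) v → 3 Data.Nat.≤ degree (deleteAt (adj Gpre) D) v
mainTheorem6 _ _ _ _ n Gpre σ D deleted⇒eligible _ v =
  deleteAt-preserves-good (adj Gpre) D (λ u du → proj₁ (proj₁ (deleted⇒eligible u du)))
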